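{- Let $C\geq 2$ and $k\geq 1$ be integers. Then $\mathrm{rad}_{P,k}(WKP_{(C,2)})=2$ if $k\geq C$, and $\mathrm{rad}_{P,k}(WKP_{(C,2)})=3$ if $k\in\{1,\dots,C-1\}$.
   Context: For a graph $G$, $S\subseteq V(G)$ and an integer $k\ge 0$, define $\mathcal{P}^0_{G,k}(S)=N_G[S]$ (closed neighbourhood of $S$) and $\mathcal{P}^{i+1}_{G,k}(S)=\bigcup\{N_G[v] : v\in \mathcal{P}^i_{G,k}(S),\ |N_G[v]\setminus \mathcal{P}^i_{G,k}(S)|\le k\}$. These sets increase and stabilize at a set $\mathcal{P}^\infty_{G,k}(S)$. A $k$-power dominating set ($k$-PDS) is a set $S$ with $\mathcal{P}^\infty_{G,k}(S)=V(G)$, and $\gamma_{P,k}(G)$ is the minimum cardinality of a $k$-PDS of $G$. For a $k$-PDS $S$ of $G$, its radius is $\mathrm{rad}_{P,k}(G,S)=1+\min\{i : \mathcal{P}^i_{G,k}(S)=V(G)\}$, and the $k$-propagation radius of $G$ is $\mathrm{rad}_{P,k}(G)=\min\{\mathrm{rad}_{P,k}(G,S) : S \text{ a } k\text{ -PDS of } G,\ |S|=\gamma_{P,k}(G)\}$. Let $[C]_0=\{0,\dots,C-1\}$. The WK-Pyramid network $WKP_{(C,L)}$ has vertex set $\{(r,(a_r a_{r-1}\cdots a_1)) : r\in\{1,\dots,L\},\ a_i\in[C]_0\}\cup\{(0,(1))\}$; a vertex $(r,(a_r\cdots a_1))$ is said to be at level $r$. The vertex $(0,(1))$ is adjacent to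 every vertex at level $1$. A vertex $(r,(a_r\cdots a_1))$ with $r>0$ is adjacent to: (1) the vertices $(r,(a_r\cdots a_2 b))$ with $b\in[C]_0$, $b\ne a_1$; (2) the vertex $(r,(a_r\cdots a_{j+1}a_{j-1}(a_j)^{j-1}))$ if there is a $j$ with $2\le j\le r$, $a_{j-1}=a_{j-2}=\cdots=a_1$ and $a_j\ne a_{j-1}$, where $(a_j)^{j-1}$ denotes $a_j$ repeated $j-1$ times; (3) the vertices $(r+1,(a_r\cdots a_1 b))$ for $b\in[C]_0$ (when $r<L$); (4) the vertex $(r-1,(a_r\cdots a_2))$ (for $r=1$ this is $(0,(1))$). -}

module Defs where

open import Data.Bool using (Bool; true; false; _∧_; _∨_; not)
open import Data.Nat using (ℕ; zero; suc; _≤_; _<_; _≤ᵇ_; _<ᵇ_; _∸_; _+_)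
open import Data.List using (List; []; _∷_; length; filterᵇ; map; concatMap; replicate; _++_; upTo; drop; take; allFin)
open import Data.List.Membership.Propositional using (_∈_)
open import Data.List.Relation.Unary.All using (All)
open import Data.List.Relation.Unary.Unique.Propositional using (Unique)
open import Data.Fin using (Fin)
open import Data.Bool.ListAction using (any; all)
open import Data.Fin.Properties using () renaming (_≟_ to _≟F_)
open import Data.List.Properties using (≡-dec)
open import Relation.Nullary using (¬_)
open import Relation.Nullary.Decidable using (⌊_⌋)
open import Relation.Binary using (DecidableEquality)
open import Data.Product using (Σ; _×_; ∃)
open import Relation.Binary.PropositionalEquality using (_≡_)

-- The graph is given by a duplicate-free list `verts` of its vertices
-- (the vertex set V(G)) and a Boolean adjacency relation `adj`.
-- Subsets of V(G) are duplicate-free lists of elements of `verts`,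
-- their cardinality is the length of the list.

module PowerDomination {V : Set} (_≟_ : DecidableEquality V)
                       (verts : List V) (adj : V → V → Bool) where

  inN : V → V → Bool
  inN v u = ⌊ u ≟ v ⌋ ∨ adj v u

  P : ℕ → ℕ → List V → V → Bool
  outside : ℕ → ℕ → List V → V → ℕ

  P k zero    S u = any (λ s → inN s u) S
  P k (suc i) S u =
    any (λ v → P k i S v ∧ (outside k i S v ≤ᵇ k) ∧ inN v u) verts

  outside k i S v = length (filterᵇ (λ w → inN v w ∧ not (P k i S w)) verts)

  Full : ℕ → ℕ → List V → Set
  Full k i S = ∀ v → v ∈ verts → P k i S v ≡ true

  IsSubset : List V → Set
  IsSubset S = Unique S × All (_∈ verts) S

  IsPDS : ℕ → List V → Set
  IsPDS k S = IsSubset S × ∃ (λ i → Full k i S)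

  IsMinPDS : ℕ → List V → Set
  IsMinPDS k S = IsPDS k S × (∀ T → IsPDS k T → length S ≤ length T)

  RadOf : ℕ → List V → ℕ → Set
  RadOf k S r = Σ ℕ (λ i → (r ≡ suc i) × Full k i S × (∀ j → j < i → ¬ Full k j S))

  IsRad : ℕ → ℕ → Set
  IsRad k r =
    Σ (List V) (λ S → IsMinPDS k S × RadOf k S r)
    × (∀ S r' → IsMinPDS k S → RadOf k S r' → r ≤ r')

-- A vertex (r,(a_r a_{r-1} ... a_1)) is encoded as the list
-- a_1 ∷ a_2 ∷ ... ∷ a_r ∷ []  (least significant digit first),
-- so its level is the length of the list; the apex (0,(1)) is [].

Word : ℕ → Set
Word C = List (Fin C)

_==F_ : ∀ {C} → Fin C → Fin C → Bool
x ==F y = ⌊ x ≟F y ⌋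

_==W_ : ∀ {C} → Word C → Word C → Bool
xs ==W ys = ⌊ ≡-dec _≟F_ xs ys ⌋

level : (C r : ℕ) → List (Word C)
level C zero    = [] ∷ []
level C (suc r) = concatMap (λ t → map (λ b → b ∷ t) (allFin C)) (level C r)

wkpVerts : (C L : ℕ) → List (Word C)
wkpVerts C L = concatMap (level C) (upTo (suc L))

rule1 : ∀ {C} → Word C → Word C → Bool
rule1 []      _        = false
rule1 (_ ∷ _) []       = false
rule1 (x ∷ t) (y ∷ t') = not (x ==F y) ∧ (t ==W t')

-- rule (2) for a given j (2 ≤ j ≤ r): a_{j-1} = ... = a_1, a_j ≠ a_{j-1},
-- neighbour (a_r ... a_{j+1} a_{j-1} (a_j)^{j-1})
rule2j : ∀ {C} → ℕ → Word C → Word C → Bool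
rule2j j []         ys = false
rule2j j (a1 ∷ xs') ys with drop (j ∸ 1) (a1 ∷ xs')
... | []        = false
... | aj ∷ rest =
  all (λ a → a ==F a1) (take (j ∸ 1) (a1 ∷ xs'))
  ∧ not (aj ==F a1)
  ∧ (ys ==W (replicate (j ∸ 1) aj ++ (a1 ∷ rest)))

rule2 : ∀ {C} → Word C → Word C → Bool
rule2 xs ys = any (λ t → rule2j (2 + t) xs ys) (upTo (length xs ∸ 1))

rule3 : ∀ {C} → ℕ → Word C → Word C → Bool
rule3 L xs []      = false
rule3 L xs (_ ∷ t) = (length xs <ᵇ L) ∧ (t ==W xs)

rule4 : ∀ {C} → Word C → Word C → Bool
rule4 []      ys = false
rule4 (_ ∷ t) ys = t ==W ys

wkpAdj : (C L : ℕ) → Word C → Word C → Bool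
wkpAdj C L xs ys = rule1 xs ys ∨ rule2 xs ys ∨ rule3 L xs ys ∨ rule4 xs ys

module WKPDom (C L : ℕ) = PowerDomination (≡-dec (_≟F_ {C})) (wkpVerts C L) (wkpAdj C L)

RadWKP : (C L k r : ℕ) → Set
RadWKP C L k r = WKPDom.IsRad C L k r

-- Call branch a the level-1 vertex a together with its children. Every neighbour of a level-2
-- vertex y ∷ x lies in branch x or is its transpose x ∷ y, in branch y. So if a set A of more than
-- k letters avoids the branches of S, the square A × A is a fort: each neighbour of it sees the |A|
-- children of its own branch inside the square and never propagates. A set S meets at most |S|
-- branches; hence every k-PDS has at least C ∸ k vertices, and if |S| < C some diagonal vertex
-- a ∷ a is unobserved at step 0.
-- If C ≤ k, the apex observes levels 0 and 1 and then every level-1 vertex has only its C ≤ k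
-- children left: radius 2. If k < C, the level-1 vertices outside k letters observe everything in
-- two steps (level-2 vertices in, or transposed into, an observed branch first; then each level-1
-- vertex misses only its k remaining children). Conversely, for a minimum S and a letter a outside
-- its branches, an observer of a ∷ a at step 1 lies in branch a and still sees more than k
-- unobserved vertices: a ∷ [] and the children b ∷ a whose transposes a ∷ b are not in S.

module Submission where

open import Data.Bool using (Bool; true; false; T; not; _∧_)
open import Data.Bool.Properties using (T-∧; T-∨; T-≡)
open import Data.Empty using (⊥-elim)
open import Data.Fin using (Fin)
open import Data.Maybe using (Maybe; just; nothing)
import Data.Maybe.Properties as Maybe
open import Data.List using (List; []; _∷_; _++_; take; drop; length; map; filter; filterᵇ; concatMap; cartesianProductWith; allFin; upTo)
open import Data.List.Properties using (length-++; length-take; length-drop; take++drop≡id; length-map; length-tabulate; ∷-injective; ≡-dec)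
open import Data.List.Membership.Propositional using (_∈_; _∉_; find; lose)
open import Data.List.Membership.Propositional.Properties using (∈-∃++; ∈-++⁻; ∈-++⁺ˡ; ∈-++⁺ʳ; ∈-filter⁺; ∈-filter⁻; ∈-cartesianProductWith⁺; ∈-cartesianProductWith⁻; ∈-allFin; ∈-concatMap⁺; ∈-concatMap⁻; ∈-upTo⁺; ∈-upTo⁻; ∈-map⁺; ∈-map⁻)
open import Data.List.Relation.Binary.Subset.Propositional using (_⊆_)
open import Data.List.Relation.Unary.All as All using (All; []; _∷_)
import Data.List.Relation.Unary.All.Properties as All
import Data.List.Relation.Unary.AllPairs as AllPairs
import Data.List.Relation.Unary.AllPairs.Properties as AllPairs
open import Data.List.Relation.Binary.Disjoint.Propositional using (Disjoint)
open import Data.List.Relation.Unary.Any using (here; there)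
open import Data.List.Relation.Unary.Any.Properties using (any⁺; any⁻)
open import Data.List.Relation.Unary.Unique.Propositional using (Unique; []; _∷_)
import Data.List.Relation.Unary.Unique.Propositional.Properties as Unique
open import Data.Nat using (ℕ; zero; suc; _≤_; _<_; z≤n; s≤s; _+_; _∸_; _⊓_; _≤ᵇ_; _<ᵇ_)
open import Data.Nat.Properties using (module ≤-Reasoning; ∸-monoʳ-<; +-comm; +-cancelˡ-≤; ≤-reflexive; m≤n⇒m⊓n≡m; m<n⇒0<n∸m; ≤-<-trans; m∸n+n≡m; <⇒≤; +-monoˡ-<; +-assoc; +-identityʳ; +-cancelˡ-<; <-≤-trans; +-monoˡ-≤; <⇒<ᵇ; <ᵇ⇒<; ≤-trans; ≤-pred; <-irrefl; ≤ᵇ⇒≤; ≤⇒≤ᵇ; ≮⇒≥; +-suc)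
open import Data.Product using (∃; ∃₂; _×_; _,_; proj₁; proj₂)
open import Data.Sum using (_⊎_; inj₁; inj₂)
open import Function using (_∘_; id; case_of_; Equivalence)
open import Relation.Binary using (DecidableEquality)
open import Relation.Binary.PropositionalEquality using (_≡_; _≢_; refl; sym; trans; cong; subst)
open import Relation.Nullary using (¬_; Dec; contradiction; yes; no)
open import Relation.Nullary.Decidable using (⌊_⌋; ¬?; map′; T?; toWitness; fromWitness; toWitnessFalse; fromWitnessFalse)
open import Relation.Unary using (Decidable)

open import Defs
open import Data.Fin.Properties using () renaming (_≟_ to _≟F_)

open Equivalence using (to; from)

module _ {A : Set} where

  unique-⊆⇒length≤ : {xs ys : List A} → Unique xs → xs ⊆ ys → length xs ≤ length ys
  unique-⊆⇒length≤ {[]}     _            _   = z≤n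
  unique-⊆⇒length≤ {x ∷ xs} (x∉xs ∷ xs!) x∷xs⊆ys with ∈-∃++ (x∷xs⊆ys (here refl))
  ... | ys₁ , ys₂ , refl = begin
    suc (length xs)                  ≤⟨ s≤s (unique-⊆⇒length≤ xs! xs⊆ys₁++ys₂) ⟩
    suc (length (ys₁ ++ ys₂))        ≡⟨ cong suc (length-++ ys₁) ⟩
    suc (length ys₁ + length ys₂)    ≡⟨ +-suc (length ys₁) (length ys₂) ⟨
    length ys₁ + length (x ∷ ys₂)    ≡⟨ length-++ ys₁ ⟨
    length (ys₁ ++ x ∷ ys₂)          ∎
    where
    open ≤-Reasoning
    xs⊆ys₁++ys₂ : xs ⊆ ys₁ ++ ys₂
    xs⊆ys₁++ys₂ {z} z∈xs with ∈-++⁻ ys₁ (x∷xs⊆ys (there z∈xs))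
    ... | inj₁ z∈ys₁         = ∈-++⁺ˡ z∈ys₁
    ... | inj₂ (here refl)   = contradiction refl (All.lookup x∉xs z∈xs)
    ... | inj₂ (there z∈ys₂) = ∈-++⁺ʳ ys₁ z∈ys₂

  length>⇒∃∈ : ∀ {n} {xs : List A} → n < length xs → ∃ (_∈ xs)
  length>⇒∃∈ {xs = x ∷ _} _ = x , here refl

  length-filter+length-filter-∁ : {P : A → Set} (P? : Decidable P) (xs : List A) →
                                  length (filter P? xs) + length (filter (¬? ∘ P?) xs) ≡ length xs
  length-filter+length-filter-∁ P? []       = refl
  length-filter+length-filter-∁ P? (x ∷ xs) with P? x
  ... | yes _ = cong suc (length-filter+length-filter-∁ P? xs)
  ... | no  _ = trans (+-suc _ _) (cong suc (length-filter+length-filter-∁ P? xs))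

module _ {A B : Set} (_≟_ : DecidableEquality B) where

  open import Data.List.Membership.DecPropositional _≟_ using (_∈?_)

  missed : (A → B) → List B → List A → List A
  missed f ys = filter (λ x → ¬? (f x ∈? ys))

  -- The elements of xs whose image lies in ys inject, together with zs, into ys.
  length-missed-bound :
    ∀ {f : A → B} → (∀ {x y} → f x ≡ f y → x ≡ y) → ∀ {xs ys zs} → Unique xs → Unique zs →
    zs ⊆ ys → (∀ {x} → x ∈ xs → f x ∉ zs) →
    length zs + length xs ≤ length ys + length (missed f ys xs)
  length-missed-bound {f} f-inj {xs} {ys} {zs} xs! zs! zs⊆ys image∉zs = begin
    length zs + length xs
      ≡⟨ cong (length zs +_) (length-filter+length-filter-∁ hit? xs) ⟨
    length zs + (length hits + length (missed f ys xs)) ≡⟨ +-assoc (length zs) _ _ ⟨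
    length zs + length hits + length (missed f ys xs)   ≤⟨ +-monoˡ-≤ _ zs+hits≤ys ⟩
    length ys + length (missed f ys xs)                 ∎
    where
    open ≤-Reasoning
    hit? : Decidable (λ x → f x ∈ ys)
    hit? x = f x ∈? ys
    hits : List A
    hits = filter hit? xs
    zs+hits≤ys : length zs + length hits ≤ length ys
    zs+hits≤ys = subst (_≤ length ys) (trans (length-++ zs) (cong (length zs +_) (length-map f hits)))
      (unique-⊆⇒length≤ (Unique.++⁺ zs! (Unique.map⁺ f-inj (Unique.filter⁺ hit? xs!)) disjoint) ⊆ys)
      where
      disjoint : Disjoint zs (map f hits)
      disjoint (y∈zs , y∈map) with ∈-map⁻ f y∈map
      ... | x , x∈hits , refl = image∉zs (proj₁ (∈-filter⁻ hit? {xs = xs} x∈hits)) y∈zs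
      ⊆ys : zs ++ map f hits ⊆ ys
      ⊆ys y∈ with ∈-++⁻ zs y∈
      ... | inj₁ y∈zs = zs⊆ys y∈zs
      ... | inj₂ y∈map with ∈-map⁻ f y∈map
      ... | x , x∈hits , refl = proj₂ (∈-filter⁻ hit? {xs = xs} x∈hits)

T-not⁺ : ∀ {b} → ¬ T b → T (not b)
T-not⁺ {false} _  = _
T-not⁺ {true}  ¬b = ¬b _

T-not⁻ : ∀ {b} → T (not b) → ¬ T b
T-not⁻ {false} _ ()

module PowerDominationProperties {V : Set} (_≟_ : DecidableEquality V) (verts : List V)
                                 (adj : V → V → Bool) (verts! : Unique verts) where

  open PowerDomination _≟_ verts adj

  inN-refl : ∀ v → T (inN v v)
  inN-refl v = from (T-∨ {⌊ v ≟ v ⌋}) (inj₁ (fromWitness refl))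

  adj⇒inN : ∀ {v w} → T (adj v w) → T (inN v w)
  adj⇒inN {v} {w} v~w = from (T-∨ {⌊ w ≟ v ⌋}) (inj₂ v~w)

  inN⇒≡⊎adj : ∀ {v w} → T (inN v w) → w ≡ v ⊎ T (adj v w)
  inN⇒≡⊎adj {v} {w} v∼w with to (T-∨ {⌊ w ≟ v ⌋}) v∼w
  ... | inj₁ w≡v = inj₁ (toWitness w≡v)
  ... | inj₂ v~w = inj₂ v~w

  module Propagation (k : ℕ) where

    -- Wrapping the Boolean membership in a record keeps i and S inferable.
    record Observed (i : ℕ) (S : List V) (u : V) : Set where
      constructor observed
      field isObserved : T (P k i S u)

    record Propagates (i : ℕ) (S : List V) (v : V) : Set where
      constructor propagates
      field
        ∈verts     : v ∈ verts
        isObserved : Observed i S v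
        outside≤k  : outside k i S v ≤ k

    Observed? : ∀ i S u → Dec (Observed i S u)
    Observed? i S u = map′ observed Observed.isObserved (T? (P k i S u))

    unobservedNeighbours : ℕ → List V → V → List V
    unobservedNeighbours i S v = filterᵇ (λ w → inN v w ∧ not (P k i S w)) verts

    Observed-zero⁺ : ∀ {S s u} → s ∈ S → T (inN s u) → Observed 0 S u
    Observed-zero⁺ s∈S s∼u = observed (any⁺ _ (lose s∈S s∼u))

    Observed-zero⁻ : ∀ {S u} → Observed 0 S u → ∃ λ s → s ∈ S × T (inN s u)
    Observed-zero⁻ {S} {u} (observed u∈P) = find (any⁻ (λ s → inN s u) S u∈P)

    Observed-suc⁺ : ∀ {i S v u} → Propagates i S v → T (inN v u) → Observed (suc i) S u
    Observed-suc⁺ (propagates v∈V (observed v∈P) out≤k) v∼u =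
      observed (any⁺ _ (lose v∈V (from T-∧ (v∈P , from T-∧ (≤⇒≤ᵇ out≤k , v∼u)))))

    Observed-suc⁻ : ∀ {i S u} → Observed (suc i) S u → ∃ λ v → Propagates i S v × T (inN v u)
    Observed-suc⁻ {i} {S} {u} (observed u∈P)
      with find (any⁻ (λ v → P k i S v ∧ (outside k i S v ≤ᵇ k) ∧ inN v u) verts u∈P)
    ... | v , v∈V , propagation with to T-∧ propagation
    ... | v∈P , rest with to T-∧ rest
    ... | out≤k , v∼u = v , propagates v∈V (observed v∈P) (≤ᵇ⇒≤ _ _ out≤k) , v∼u

    propagates-if-few-unobserved :
      ∀ {i S v} (L : List V) → v ∈ verts → Observed i S v →
      (∀ {w} → w ∈ verts → T (inN v w) → ¬ Observed i S w → w ∈ L) → length L ≤ k →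
      Propagates i S v
    propagates-if-few-unobserved {i} {S} {v} L v∈V v∈P unobserved⊆L |L|≤k =
      propagates v∈V v∈P
        (≤-trans (unique-⊆⇒length≤ (Unique.filter⁺ _ verts!) unobserved⊆filter) |L|≤k)
      where
      unobserved⊆filter : unobservedNeighbours i S v ⊆ L
      unobserved⊆filter w∈out =
        let w∈V , e = ∈-filter⁻ _ w∈out
            v∼w , w∉P = to T-∧ e
        in unobserved⊆L w∈V v∼w λ { (observed w∈P) → T-not⁻ w∉P w∈P }

    ¬propagates-if-many-unobserved :
      ∀ {i S v} {L : List V} → Unique L → k < length L →
      (∀ {w} → w ∈ L → w ∈ verts × T (inN v w) × ¬ Observed i S w) → ¬ Propagates i S v
    ¬propagates-if-many-unobserved {i} {S} {v} {L} L! k<|L| L⊆unobserved (propagates _ _ out≤k) =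
      <-irrefl refl (≤-trans k<|L| (≤-trans (unique-⊆⇒length≤ L! L⊆filter) out≤k))
      where
      L⊆filter : L ⊆ unobservedNeighbours i S v
      L⊆filter w∈L =
        let w∈V , v∼w , w∉P = L⊆unobserved w∈L
        in ∈-filter⁺ _ w∈V (from T-∧ (v∼w , T-not⁺ λ w∈P → w∉P (observed w∈P)))

    saturated⇒propagates : ∀ {i S v} → v ∈ verts → Observed i S v →
                           (∀ {w} → T (inN v w) → Observed i S w) → Propagates i S v
    saturated⇒propagates v∈V v∈P N[v]⊆P =
      propagates-if-few-unobserved [] v∈V v∈P (λ _ v∼w w∉P → contradiction (N[v]⊆P v∼w) w∉P) z≤n

    Observed-mono : ∀ {S} → All (_∈ verts) S → ∀ i {u} → Observed i S u → Observed (suc i) S u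
    Observed-mono S⊆V zero u∈P with Observed-zero⁻ u∈P
    ... | s , s∈S , s∼u = Observed-suc⁺ (saturated⇒propagates (All.lookup S⊆V s∈S)
                            (Observed-zero⁺ s∈S (inN-refl s)) (Observed-zero⁺ s∈S)) s∼u
    Observed-mono S⊆V (suc i) u∈P with Observed-suc⁻ u∈P
    ... | v , v↝ , v∼u = Observed-suc⁺ (saturated⇒propagates (Propagates.∈verts v↝)
                            (Observed-suc⁺ v↝ (inN-refl v)) (Observed-suc⁺ v↝)) v∼u

    ¬Observed-[] : ∀ i {u} → ¬ Observed i [] u
    ¬Observed-[] zero    (observed ())
    ¬Observed-[] (suc i) u∈P with Observed-suc⁻ u∈P
    ... | _ , v↝ , _ = ¬Observed-[] i (Propagates.isObserved v↝)

    Full⁺ : ∀ {i S} → (∀ {v} → v ∈ verts → Observed i S v) → Full k i S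
    Full⁺ all-observed v v∈V = to T-≡ (Observed.isObserved (all-observed v∈V))

    Full⁻ : ∀ {i S v} → Full k i S → v ∈ verts → Observed i S v
    Full⁻ full v∈V = observed (from T-≡ (full _ v∈V))

    IsFort : (V → Set) → Set
    IsFort F = ∀ {v w} → v ∈ verts → F w → T (inN v w) →
               ∃ λ L → Unique L × k < length L × (∀ {u} → u ∈ L → u ∈ verts × F u × T (inN v u))

    fort-unobserved : ∀ {F S} → IsFort F → (∀ {w} → F w → ¬ Observed 0 S w) →
                      ∀ i {w} → F w → ¬ Observed i S w
    fort-unobserved fort F∩P⁰=∅ zero    w∈F = F∩P⁰=∅ w∈F
    fort-unobserved fort F∩P⁰=∅ (suc i) w∈F w∈P with Observed-suc⁻ w∈P
    ... | v , v↝ , v∼w with fort (Propagates.∈verts v↝) w∈F v∼w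
    ... | L , L! , k<|L| , L⊆F∩N[v] = ¬propagates-if-many-unobserved L! k<|L|
            (λ u∈L → let u∈V , u∈F , v∼u = L⊆F∩N[v] u∈L
                     in u∈V , v∼u , fort-unobserved fort F∩P⁰=∅ i u∈F) v↝

    minPDS⊆verts : ∀ {S} → IsMinPDS k S → All (_∈ verts) S
    minPDS⊆verts (((_ , S⊆V) , _) , _) = S⊆V

    isRad-intro : ∀ {S i} → IsMinPDS k S → Full k i S →
                  (∀ T → IsMinPDS k T → ∀ j → j < i → ¬ Full k j T) → IsRad k (suc i)
    isRad-intro {S} {i} S-min S-full faster-impossible =
      (S , S-min , i , refl , S-full , faster-impossible S S-min) ,
      λ { T _ T-min (j , refl , T-full , _) → s≤s (≮⇒≥ λ j<i → faster-impossible T T-min j j<i T-full) }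

concatMap-map≡cartesianProductWith :
  ∀ {A B X : Set} (f : A → B → X) (xs : List A) (ys : List B) →
  concatMap (λ x → map (f x) ys) xs ≡ cartesianProductWith f xs ys
concatMap-map≡cartesianProductWith f []       ys = refl
concatMap-map≡cartesianProductWith f (x ∷ xs) ys =
  cong (map (f x) ys ++_) (concatMap-map≡cartesianProductWith f xs ys)

length-allFin : ∀ n → length (allFin n) ≡ n
length-allFin n = length-tabulate id

module WKPVertices (C : ℕ) where

  extend : Word C → Fin C → Word C
  extend t b = b ∷ t

  level-suc : ∀ r → level C (suc r) ≡ cartesianProductWith extend (level C r) (allFin C)
  level-suc r = concatMap-map≡cartesianProductWith extend (level C r) (allFin C)

  ∈-level⁺ : ∀ (w : Word C) → w ∈ level C (length w)
  ∈-level⁺ []      = here refl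
  ∈-level⁺ (b ∷ t) = subst (b ∷ t ∈_) (sym (level-suc (length t)))
                       (∈-cartesianProductWith⁺ extend (∈-level⁺ t) (∈-allFin b))

  ∈-level⁻ : ∀ r {w} → w ∈ level C r → length w ≡ r
  ∈-level⁻ zero    (here refl) = refl
  ∈-level⁻ (suc r) w∈level
    with ∈-cartesianProductWith⁻ extend (level C r) (allFin C) (subst (_ ∈_) (level-suc r) w∈level)
  ... | t , b , t∈level , _ , refl = cong suc (∈-level⁻ r t∈level)

  level-unique : ∀ r → Unique (level C r)
  level-unique zero    = [] ∷ []
  level-unique (suc r) = subst Unique (sym (level-suc r))
    (Unique.cartesianProductWith⁺ extend (λ e → let b≡b' , t≡t' = ∷-injective e in t≡t' , b≡b')
                                   (level-unique r) (Unique.allFin⁺ C))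

  level-disjoint : ∀ {r r'} → r ≢ r' → Disjoint (level C r) (level C r')
  level-disjoint r≢r' (w∈r , w∈r') = r≢r' (trans (sym (∈-level⁻ _ w∈r)) (∈-level⁻ _ w∈r'))

  ∈-wkpVerts⁺ : ∀ {L} (w : Word C) → length w ≤ L → w ∈ wkpVerts C L
  ∈-wkpVerts⁺ w |w|≤L = ∈-concatMap⁺ (level C) (lose (∈-upTo⁺ (s≤s |w|≤L)) (∈-level⁺ w))

  ∈-wkpVerts⁻ : ∀ {L w} → w ∈ wkpVerts C L → length w ≤ L
  ∈-wkpVerts⁻ {L} w∈V with find (∈-concatMap⁻ (level C) {xs = upTo (suc L)} w∈V)
  ... | r , r∈upTo , w∈level = subst (_≤ L) (sym (∈-level⁻ r w∈level)) (≤-pred (∈-upTo⁻ r∈upTo))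

  wkpVerts-unique : ∀ L → Unique (wkpVerts C L)
  wkpVerts-unique L =
    Unique.concat⁺ (All.map⁺ {f = level C} (All.universal level-unique (upTo (suc L))))
                   (AllPairs.map⁺ {f = level C} (AllPairs.map level-disjoint (Unique.upTo⁺ (suc L))))

module WKP₂ (C : ℕ) where

  open WKPVertices C
  open PowerDomination (≡-dec (_≟F_ {C})) (wkpVerts C 2) (wkpAdj C 2) using (inN)
  open PowerDominationProperties (≡-dec (_≟F_ {C})) (wkpVerts C 2) (wkpAdj C 2) (wkpVerts-unique 2)
    using (inN-refl; adj⇒inN; inN⇒≡⊎adj)

  -- Closed neighbourhood of WKP(C,2). Rules (1), (3), (4) become ∼-sibling, ∼-child,
  -- ∼-parent; rule (2) only applies with j = 2 and exchanges the two digits (∼-swap).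
  infix 4 _∼_
  data _∼_ : Word C → Word C → Set where
    ∼-refl    : ∀ {v} → v ∼ v
    ∼-child   : ∀ {t} b → length t < 2 → t ∼ b ∷ t
    ∼-parent  : ∀ {t} b → length t < 2 → b ∷ t ∼ t
    ∼-sibling : ∀ {t} b b' → b ∷ t ∼ b' ∷ t
    ∼-swap    : ∀ {x y} → x ≢ y → y ∷ x ∷ [] ∼ x ∷ y ∷ []

  ∼-sym : ∀ {v w} → v ∼ w → w ∼ v
  ∼-sym ∼-refl              = ∼-refl
  ∼-sym (∼-child b |t|<2)   = ∼-parent b |t|<2
  ∼-sym (∼-parent b |t|<2)  = ∼-child b |t|<2
  ∼-sym (∼-sibling b b')    = ∼-sibling b' b
  ∼-sym (∼-swap x≢y)        = ∼-swap (x≢y ∘ sym)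

  module _ {v w : Word C} where

    rule1⇒inN : T (rule1 v w) → T (inN v w)
    rule1⇒inN r = adj⇒inN {v} {w} (from (T-∨ {rule1 v w}) (inj₁ r))

    rule2⇒inN : T (rule2 v w) → T (inN v w)
    rule2⇒inN r = adj⇒inN {v} {w} (from (T-∨ {rule1 v w}) (inj₂ (from (T-∨ {rule2 v w}) (inj₁ r))))

    rule3⇒inN : T (rule3 2 v w) → T (inN v w)
    rule3⇒inN r = adj⇒inN {v} {w} (from (T-∨ {rule1 v w}) (inj₂ (from (T-∨ {rule2 v w})
                    (inj₂ (from (T-∨ {rule3 2 v w}) (inj₁ r))))))

    rule4⇒inN : T (rule4 v w) → T (inN v w)
    rule4⇒inN r = adj⇒inN {v} {w} (from (T-∨ {rule1 v w}) (inj₂ (from (T-∨ {rule2 v w})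
                    (inj₂ (from (T-∨ {rule3 2 v w}) (inj₂ r))))))

  ∼⇒inN : ∀ {v w} → v ∼ w → T (inN v w)
  ∼⇒inN {v} ∼-refl                 = inN-refl v
  ∼⇒inN {t} (∼-child b |t|<2)       = rule3⇒inN {t} (from T-∧ (<⇒<ᵇ |t|<2 , fromWitness refl))
  ∼⇒inN {_} {t} (∼-parent b _)      = rule4⇒inN {w = t} (fromWitness refl)
  ∼⇒inN (∼-sibling b b') = sibling⇒inN (b ≟F b')
    where
    sibling⇒inN : ∀ {t} → Dec (b ≡ b') → T (inN (b ∷ t) (b' ∷ t))
    sibling⇒inN {t} (yes refl) = inN-refl (b ∷ t)
    sibling⇒inN {t} (no b≢b')  =
      rule1⇒inN {b ∷ t} {b' ∷ t} (from (T-∧ {not (b ==F b')}) (fromWitnessFalse b≢b' , fromWitness refl))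
  ∼⇒inN {y ∷ x ∷ []} {w} (∼-swap x≢y) = rule2⇒inN {y ∷ x ∷ []} {w} (swap⇒rule2 x≢y)
    where
    swap⇒rule2 : ∀ {x y} → x ≢ y → T (rule2 (y ∷ x ∷ []) (x ∷ y ∷ []))
    swap⇒rule2 {x} {y} x≢y = from (T-∨ {rule2j 2 (y ∷ x ∷ []) (x ∷ y ∷ [])}) (inj₁
      (from (T-∧ {(y ==F y) ∧ true}) (from (T-∧ {y ==F y}) (fromWitness refl , _) ,
        from (T-∧ {not (x ==F y)}) (fromWitnessFalse x≢y , fromWitness refl))))

  rule1⇒∼ : ∀ {v w} → T (rule1 v w) → v ∼ w
  rule1⇒∼ {b ∷ t} {b' ∷ t'} r with toWitness (proj₂ (to (T-∧ {not (b ==F b')}) r))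
  ... | refl = ∼-sibling b b'

  rule2⇒∼ : ∀ {v w} → length v ≤ 2 → T (rule2 v w) → v ∼ w
  rule2⇒∼ {y ∷ x ∷ []} {w} _ r with to (T-∨ {rule2j 2 (y ∷ x ∷ []) w}) r
  ... | inj₁ r' with to (T-∧ {(y ==F y) ∧ true}) r'
  ... | _ , r'' with to (T-∧ {not (x ==F y)}) r''
  ... | x≢y , w≡ with toWitness w≡
  ... | refl = ∼-swap (toWitnessFalse x≢y)
  rule2⇒∼ {_ ∷ _ ∷ _ ∷ _} (s≤s (s≤s ()))

  rule3⇒∼ : ∀ {v w} → T (rule3 2 v w) → v ∼ w
  rule3⇒∼ {v} {b ∷ t} r with to (T-∧ {length v <ᵇ 2}) r
  ... | |v|<2 , t≡v with toWitness t≡v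
  ... | refl = ∼-child b (<ᵇ⇒< _ _ |v|<2)

  rule4⇒∼ : ∀ {v w} → length v ≤ 2 → T (rule4 v w) → v ∼ w
  rule4⇒∼ {b ∷ t} (s≤s |t|≤1) r with toWitness r
  ... | refl = ∼-parent b (s≤s |t|≤1)

  inN⇒∼ : ∀ {v w} → v ∈ wkpVerts C 2 → T (inN v w) → v ∼ w
  inN⇒∼ {v} {w} v∈V v∼w with inN⇒≡⊎adj {v} {w} v∼w
  ... | inj₁ refl = ∼-refl
  ... | inj₂ v~w with to (T-∨ {rule1 v w}) v~w
  ... | inj₁ r₁ = rule1⇒∼ r₁
  ... | inj₂ r with to (T-∨ {rule2 v w}) r
  ... | inj₁ r₂ = rule2⇒∼ (∈-wkpVerts⁻ v∈V) r₂
  ... | inj₂ r' with to (T-∨ {rule3 2 v w}) r'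
  ... | inj₁ r₃ = rule3⇒∼ r₃
  ... | inj₂ r₄ = rule4⇒∼ (∈-wkpVerts⁻ v∈V) r₄

  branch : Word C → Maybe (Fin C)
  branch (a ∷ [])     = just a
  branch (_ ∷ x ∷ []) = just x
  branch _            = nothing

  top-clique : ∀ {v w} → length v < 2 → length w < 2 → v ∼ w
  top-clique {[]}     {[]}     _ _ = ∼-refl
  top-clique {[]}     {b ∷ []} _ _ = ∼-child b (s≤s z≤n)
  top-clique {a ∷ []} {[]}     _ _ = ∼-parent a (s≤s z≤n)
  top-clique {a ∷ []} {b ∷ []} _ _ = ∼-sibling a b
  top-clique {_ ∷ _ ∷ _} (s≤s (s≤s ())) _
  top-clique {_} {_ ∷ _ ∷ _} _ (s≤s (s≤s ()))

  branch-parent∼ : ∀ {v a} → branch v ≡ just a → a ∷ [] ∼ v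
  branch-parent∼ {a ∷ []}     refl = ∼-refl
  branch-parent∼ {z ∷ a ∷ []} refl = ∼-child z (s≤s (s≤s z≤n))

  branch∼children : ∀ {v a} → branch v ≡ just a → ∀ b → v ∼ b ∷ a ∷ []
  branch∼children {a ∷ []}     refl b = ∼-child b (s≤s (s≤s z≤n))
  branch∼children {z ∷ a ∷ []} refl b = ∼-sibling z b

  level2≢top : ∀ {w : Word C} {y x} → y ∷ x ∷ [] ≡ w → ¬ length w < 2
  level2≢top refl (s≤s (s≤s ()))

  ∼-transpose : ∀ x y → x ∷ y ∷ [] ∼ y ∷ x ∷ []
  ∼-transpose x y with x ≟F y
  ... | yes refl = ∼-refl
  ... | no  x≢y  = ∼-swap (x≢y ∘ sym)

  ∼-into-level1 : ∀ {v a} → v ∼ a ∷ [] → length v < 2 ⊎ ∃ λ z → v ≡ z ∷ a ∷ []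
  ∼-into-level1 ∼-refl          = inj₁ (s≤s (s≤s z≤n))
  ∼-into-level1 (∼-child _ _)   = inj₁ (s≤s z≤n)
  ∼-into-level1 (∼-parent z _)  = inj₂ (z , refl)
  ∼-into-level1 (∼-sibling _ _) = inj₁ (s≤s (s≤s z≤n))

  ∼-into-level2 : ∀ {v x y} → v ∼ y ∷ x ∷ [] → branch v ≡ just x ⊎ v ≡ x ∷ y ∷ []
  ∼-into-level2 ∼-refl                      = inj₁ refl
  ∼-into-level2 (∼-child _ _)               = inj₁ refl
  ∼-into-level2 (∼-parent _ (s≤s (s≤s ())))
  ∼-into-level2 (∼-sibling _ _)             = inj₁ refl
  ∼-into-level2 (∼-swap _)                  = inj₂ refl

  ∼-diagonal⇒branch : ∀ {v a} → v ∼ a ∷ a ∷ [] → branch v ≡ just a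
  ∼-diagonal⇒branch v∼aa with ∼-into-level2 v∼aa
  ... | inj₁ branch-a = branch-a
  ... | inj₂ refl     = refl

module WKP₂Domination (C k : ℕ) where

  open WKPVertices C
  open WKP₂ C
  open WKPDom C 2
  open PowerDominationProperties (≡-dec (_≟F_ {C})) (wkpVerts C 2) (wkpAdj C 2) (wkpVerts-unique 2)
  open Propagation k
  open import Data.List.Membership.DecPropositional (_≟F_ {C}) using () renaming (_∈?_ to _∈F?_)

  apex∈V : [] ∈ wkpVerts C 2
  apex∈V = ∈-wkpVerts⁺ {2} [] z≤n

  level1∈V : ∀ a → a ∷ [] ∈ wkpVerts C 2
  level1∈V a = ∈-wkpVerts⁺ {2} (a ∷ []) (s≤s z≤n)

  level2∈V : ∀ y x → y ∷ x ∷ [] ∈ wkpVerts C 2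
  level2∈V y x = ∈-wkpVerts⁺ {2} (y ∷ x ∷ []) (s≤s (s≤s z≤n))

  parent∼level2 : ∀ y x → x ∷ [] ∼ y ∷ x ∷ []
  parent∼level2 y x = ∼-child y (s≤s (s≤s z≤n))

  observed-zero⇒∼ : ∀ {S w} → All (_∈ wkpVerts C 2) S → Observed 0 S w → ∃ λ s → s ∈ S × s ∼ w
  observed-zero⇒∼ S⊆V w∈P with Observed-zero⁻ w∈P
  ... | s , s∈S , s∼w = s , s∈S , inN⇒∼ (All.lookup S⊆V s∈S) s∼w

  ∼⇒observed-zero : ∀ {S s w} → s ∈ S → s ∼ w → Observed 0 S w
  ∼⇒observed-zero s∈S s∼w = Observed-zero⁺ s∈S (∼⇒inN s∼w)

  ∼⇒observed-suc : ∀ {i S v w} → Propagates i S v → v ∼ w → Observed (suc i) S w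
  ∼⇒observed-suc v↝ v∼w = Observed-suc⁺ v↝ (∼⇒inN v∼w)

  Unbranched : List (Word C) → Fin C → Set
  Unbranched S a = just a ∉ map branch S

  branch-∈ : ∀ {S s a} → s ∈ S → branch s ≡ just a → ¬ Unbranched S a
  branch-∈ s∈S branch-a a∉ = a∉ (subst (_∈ _) branch-a (∈-map⁺ branch s∈S))

  level2-unobserved₀ : ∀ {S x y} → All (_∈ wkpVerts C 2) S → Unbranched S x → Unbranched S y →
                       ¬ Observed 0 S (y ∷ x ∷ [])
  level2-unobserved₀ S⊆V x∉ y∉ w∈P with observed-zero⇒∼ S⊆V w∈P
  ... | s , s∈S , s∼w with ∼-into-level2 s∼w
  ... | inj₁ branch-x = branch-∈ s∈S branch-x x∉
  ... | inj₂ refl     = branch-∈ s∈S refl y∉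

  ∃-unbranched : ∀ S → ∃ λ A → Unique A × C ≤ length S + length A ×
                                (∀ {a} → a ∈ A → Unbranched S a)
  ∃-unbranched S =
    A , Unique.filter⁺ _ (Unique.allFin⁺ C) ,
    subst (_≤ length S + length A) (length-allFin C)
      (subst (λ n → length (allFin C) ≤ n + length A) (length-map branch S)
        (length-missed-bound (Maybe.≡-dec _≟F_) Maybe.just-injective
           (Unique.allFin⁺ C) [] (λ ()) (λ _ ()))) ,
    λ a∈A → proj₂ (∈-filter⁻ _ {xs = allFin C} a∈A)
    where
    A : List (Fin C)
    A = missed (Maybe.≡-dec _≟F_) just (map branch S) (allFin C)

  ∃-unbranched-letter : ∀ {S} → length S < C → ∃ (Unbranched S)
  ∃-unbranched-letter {S} |S|<C with ∃-unbranched S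
  ... | A , _ , C≤S+A , unbranched =
    let a , a∈A = length>⇒∃∈ (+-cancelˡ-< (length S) 0 (length A)
                    (<-≤-trans (subst (_< C) (sym (+-identityʳ _)) |S|<C) C≤S+A))
    in a , unbranched a∈A

  ¬Full₀ : ∀ {S} → All (_∈ wkpVerts C 2) S → length S < C → ¬ Full k 0 S
  ¬Full₀ S⊆V |S|<C full with ∃-unbranched-letter |S|<C
  ... | a , a∉ = level2-unobserved₀ S⊆V a∉ a∉ (Full⁻ full (level2∈V a a))

  children : Fin C → List (Fin C) → List (Word C)
  children g = map (λ b → b ∷ g ∷ [])

  children-unique : ∀ {g bs} → Unique bs → Unique (children g bs)
  children-unique = Unique.map⁺ (proj₁ ∘ ∷-injective)

  data Square (A : List (Fin C)) : Word C → Set where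
    square : ∀ {x y} → y ∈ A → x ∈ A → Square A (y ∷ x ∷ [])

  branch-sees-children : ∀ {A v g} → Unique A → k < length A → g ∈ A → branch v ≡ just g →
                         ∃ λ L → Unique L × k < length L ×
                           (∀ {u} → u ∈ L → u ∈ wkpVerts C 2 × Square A u × T (inN v u))
  branch-sees-children {A} {v} {g} A! k<|A| g∈A branch-g =
    children g A , children-unique A! , subst (k <_) (sym (length-map _ A)) k<|A| , λ u∈L →
      let b , b∈A , u≡ = ∈-map⁻ _ u∈L
      in subst (λ u → u ∈ wkpVerts C 2 × Square A u × T (inN v u)) (sym u≡)
           (level2∈V b g , square b∈A g∈A , ∼⇒inN (branch∼children branch-g b))

  square-fort : ∀ {A} → Unique A → k < length A → IsFort (Square A)
  square-fort A! k<|A| v∈V (square y∈A x∈A) v∼w with ∼-into-level2 (inN⇒∼ v∈V v∼w)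
  ... | inj₁ branch-x = branch-sees-children A! k<|A| x∈A branch-x
  ... | inj₂ refl     = branch-sees-children A! k<|A| y∈A refl

  square-lower-bound : k < C → ∀ {S} → IsPDS k S → C ∸ k ≤ length S
  square-lower-bound k<C {S} ((_ , S⊆V) , i , full) = ≮⇒≥ |S|≮C∸k
    where
    |S|≮C∸k : ¬ length S < C ∸ k
    |S|≮C∸k |S|<C∸k with ∃-unbranched S
    ... | A , A! , C≤S+A , unbranched =
      let |S|+k<C = subst (length S + k <_) (m∸n+n≡m (<⇒≤ k<C)) (+-monoˡ-< k |S|<C∸k)
          k<|A|   = +-cancelˡ-< (length S) k (length A) (<-≤-trans |S|+k<C C≤S+A)
          a , a∈A = length>⇒∃∈ k<|A|
          square-unobserved₀ : ∀ {w} → Square A w → ¬ Observed 0 S w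
          square-unobserved₀ = λ { (square y∈A x∈A) →
                                     level2-unobserved₀ S⊆V (unbranched x∈A) (unbranched y∈A) }
      in fort-unobserved (square-fort A! k<|A|) square-unobserved₀ i (square a∈A a∈A)
           (Full⁻ full (level2∈V a a))

  top-or-level2 : ∀ {v} → v ∈ wkpVerts C 2 → length v < 2 ⊎ ∃₂ λ y x → v ≡ y ∷ x ∷ []
  top-or-level2 {v} v∈V = split v (∈-wkpVerts⁻ v∈V)
    where
    split : ∀ v → length v ≤ 2 → length v < 2 ⊎ ∃₂ λ y x → v ≡ y ∷ x ∷ []
    split []                _               = inj₁ (s≤s z≤n)
    split (_ ∷ [])          _               = inj₁ (s≤s (s≤s z≤n))
    split (y ∷ x ∷ [])      _               = inj₂ (y , x , refl)
    split (_ ∷ _ ∷ _ ∷ _)   (s≤s (s≤s ()))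

  PDS-nonempty : ∀ {S} → IsPDS k S → 0 < length S
  PDS-nonempty {[]}    (_ , i , full) = contradiction (Full⁻ full apex∈V) (¬Observed-[] i)
  PDS-nonempty {_ ∷ _} _              = s≤s z≤n

  Full⁺-by-levels : ∀ {i S} → (∀ {w} → length w < 2 → Observed i S w) →
                    (∀ y x → Observed i S (y ∷ x ∷ [])) → Full k i S
  Full⁺-by-levels top level2 = Full⁺ λ v∈V → case top-or-level2 v∈V of λ
    { (inj₁ |v|<2)          → top |v|<2
    ; (inj₂ (y , x , refl)) → level2 y x }

  module LargeThreshold (C≤k : C ≤ k) where

    apex : List (Word C)
    apex = [] ∷ []

    apex⊆V : All (_∈ wkpVerts C 2) apex
    apex⊆V = apex∈V ∷ []

    top-observed₀ : ∀ {w} → length w < 2 → Observed 0 apex w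
    top-observed₀ |w|<2 = ∼⇒observed-zero (here refl) (top-clique (s≤s z≤n) |w|<2)

    level1-propagates₀ : ∀ x → Propagates 0 apex (x ∷ [])
    level1-propagates₀ x =
      propagates-if-few-unobserved (children x (allFin C)) (level1∈V x) (top-observed₀ (s≤s (s≤s z≤n)))
        unobserved⊆children (subst (_≤ k) (sym (trans (length-map _ (allFin C)) (length-allFin C))) C≤k)
      where
      unobserved⊆children : ∀ {w} → w ∈ wkpVerts C 2 → T (inN (x ∷ []) w) → ¬ Observed 0 apex w →
                            w ∈ children x (allFin C)
      unobserved⊆children {w} _ x∼w w∉P with ∼-into-level1 {w} (∼-sym (inN⇒∼ (level1∈V x) x∼w))
      ... | inj₁ |w|<2       = contradiction (top-observed₀ |w|<2) w∉P
      ... | inj₂ (z , refl)  = ∈-map⁺ _ (∈-allFin z)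

    apex-full₁ : Full k 1 apex
    apex-full₁ = Full⁺-by-levels (Observed-mono apex⊆V 0 ∘ top-observed₀)
                                 (λ y x → ∼⇒observed-suc (level1-propagates₀ x) (parent∼level2 y x))

    apex-minPDS : IsMinPDS k apex
    apex-minPDS = ((([] ∷ []) , apex⊆V) , 1 , apex-full₁) , λ _ → PDS-nonempty

    isRad-2 : 2 ≤ C → IsRad k 2
    isRad-2 2≤C = isRad-intro apex-minPDS apex-full₁ λ where
      S S-min zero    _         → ¬Full₀ (minPDS⊆verts S-min)
                                         (≤-<-trans (proj₂ S-min apex (proj₁ apex-minPDS)) 2≤C)
      _ _     (suc _) (s≤s ())

  module SmallThreshold (k<C : k < C) (1≤k : 1 ≤ k) where

    B rest : List (Fin C)
    B    = drop k (allFin C)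
    rest = take k (allFin C)

    S₀ : List (Word C)
    S₀ = map (_∷ []) B

    S₀-unique : Unique S₀
    S₀-unique = Unique.map⁺ (proj₁ ∘ ∷-injective) (Unique.drop⁺ k (Unique.allFin⁺ C))

    S₀⊆V : All (_∈ wkpVerts C 2) S₀
    S₀⊆V = All.map⁺ (All.universal level1∈V B)

    length-B : length B ≡ C ∸ k
    length-B = trans (length-drop k (allFin C)) (cong (_∸ k) (length-allFin C))

    length-S₀ : length S₀ ≡ C ∸ k
    length-S₀ = trans (length-map _ B) length-B

    length-rest : length rest ≡ k
    length-rest = trans (length-take k (allFin C))
                        (trans (cong (k ⊓_) (length-allFin C)) (m≤n⇒m⊓n≡m (<⇒≤ k<C)))

    ∉B⇒∈rest : ∀ {b} → b ∉ B → b ∈ rest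
    ∉B⇒∈rest {b} b∉B with ∈-++⁻ rest (subst (b ∈_) (sym (take++drop≡id k (allFin C))) (∈-allFin b))
    ... | inj₁ b∈rest = b∈rest
    ... | inj₂ b∈B    = contradiction b∈B b∉B

    top-observed₀ : ∀ {w} → length w < 2 → Observed 0 S₀ w
    top-observed₀ |w|<2 =
      let b , b∈B = length>⇒∃∈ (subst (0 <_) (sym length-B) (m<n⇒0<n∸m k<C))
      in ∼⇒observed-zero (∈-map⁺ _ b∈B) (top-clique (s≤s (s≤s z≤n)) |w|<2)

    B-branch-observed₀ : ∀ {w b} → branch w ≡ just b → b ∈ B → Observed 0 S₀ w
    B-branch-observed₀ branch-b b∈B = ∼⇒observed-zero (∈-map⁺ _ b∈B) (branch-parent∼ branch-b)

    -- y ∷ x ∷ [] is the only neighbour of x ∷ y ∷ [] outside the observed branch y.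
    B-child-observed₁ : ∀ {x y} → y ∈ B → Observed 1 S₀ (y ∷ x ∷ [])
    B-child-observed₁ {x} {y} y∈B = ∼⇒observed-suc transpose-propagates (∼-transpose x y)
      where
      transpose-propagates : Propagates 0 S₀ (x ∷ y ∷ [])
      transpose-propagates =
        propagates-if-few-unobserved ((y ∷ x ∷ []) ∷ []) (level2∈V x y) (B-branch-observed₀ refl y∈B)
          (λ w∈V xy∼w w∉P → case ∼-into-level2 (∼-sym (inN⇒∼ (level2∈V x y) xy∼w)) of λ
            { (inj₁ branch-y) → contradiction (B-branch-observed₀ branch-y y∈B) w∉P
            ; (inj₂ refl)     → here refl })
          1≤k

    level1-propagates₁ : ∀ x → Propagates 1 S₀ (x ∷ [])
    level1-propagates₁ x =
      propagates-if-few-unobserved (children x rest) (level1∈V x)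
        (Observed-mono S₀⊆V 0 (top-observed₀ (s≤s (s≤s z≤n)))) unobserved⊆children
        (≤-reflexive (trans (length-map _ rest) length-rest))
      where
      unobserved⊆children : ∀ {w} → w ∈ wkpVerts C 2 → T (inN (x ∷ []) w) → ¬ Observed 1 S₀ w →
                            w ∈ children x rest
      unobserved⊆children {w} _ x∼w w∉P with ∼-into-level1 {w} (∼-sym (inN⇒∼ (level1∈V x) x∼w))
      ... | inj₁ |w|<2      = contradiction (Observed-mono S₀⊆V 0 (top-observed₀ |w|<2)) w∉P
      ... | inj₂ (z , refl) with z ∈F? B
      ...   | yes z∈B = contradiction (B-child-observed₁ z∈B) w∉P
      ...   | no  z∉B = ∈-map⁺ _ (∉B⇒∈rest z∉B)

    S₀-full₂ : Full k 2 S₀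
    S₀-full₂ = Full⁺-by-levels (Observed-mono S₀⊆V 1 ∘ Observed-mono S₀⊆V 0 ∘ top-observed₀)
                               (λ y x → ∼⇒observed-suc (level1-propagates₁ x) (parent∼level2 y x))

    S₀-minPDS : IsMinPDS k S₀
    S₀-minPDS = ((S₀-unique , S₀⊆V) , 2 , S₀-full₂) ,
                λ T T-PDS → subst (_≤ length T) (sym length-S₀) (square-lower-bound k<C T-PDS)

    C∸k+k≡C : C ∸ k + k ≡ C
    C∸k+k≡C = m∸n+n≡m (<⇒≤ k<C)

    C∸k<C : C ∸ k < C
    C∸k<C = ∸-monoʳ-< 1≤k (<⇒≤ k<C)

    minPDS-size : ∀ {S} → IsMinPDS k S → length S ≤ C ∸ k
    minPDS-size S-min = subst (_ ≤_) length-S₀ (proj₂ S-min S₀ (proj₁ S₀-minPDS))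

    module DiagonalUnobserved₁ {S} (S⊆V : All (_∈ wkpVerts C 2) S) (|S|≤C∸k : length S ≤ C ∸ k)
                               {a} (a∉ : Unbranched S a) where

      transpose-missing : List (Fin C)
      transpose-missing = missed (≡-dec _≟F_) (λ b → a ∷ b ∷ []) S (allFin C)

      transpose-missing-unique : Unique transpose-missing
      transpose-missing-unique = Unique.filter⁺ _ (Unique.allFin⁺ C)

      transpose-missing-unobserved₀ : ∀ {b} → b ∈ transpose-missing → ¬ Observed 0 S (b ∷ a ∷ [])
      transpose-missing-unobserved₀ b∈M ba∈P with observed-zero⇒∼ S⊆V ba∈P
      ... | s , s∈S , s∼ba with ∼-into-level2 s∼ba
      ... | inj₁ branch-a = branch-∈ s∈S branch-a a∉
      ... | inj₂ refl     = proj₂ (∈-filter⁻ _ {xs = allFin C} b∈M) s∈S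

      transpose-missing-bound : ∀ {zs} → Unique zs → zs ⊆ S → (∀ {b} → a ∷ b ∷ [] ∉ zs) →
                                length zs + k ≤ length transpose-missing
      transpose-missing-bound {zs} zs! zs⊆S level2∉zs = +-cancelˡ-≤ (C ∸ k) _ _ (begin
        C ∸ k + (length zs + k)                  ≡⟨ +-assoc (C ∸ k) _ _ ⟨
        C ∸ k + length zs + k                    ≡⟨ cong (_+ k) (+-comm (C ∸ k) (length zs)) ⟩
        length zs + (C ∸ k) + k                  ≡⟨ +-assoc (length zs) _ _ ⟩
        length zs + (C ∸ k + k)                  ≡⟨ cong (length zs +_) C∸k+k≡C ⟩
        length zs + C                            ≡⟨ cong (length zs +_) (length-allFin C) ⟨
        length zs + length (allFin C)            ≤⟨ length-missed-bound (≡-dec _≟F_) transpose-injective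
                                                      (Unique.allFin⁺ C) zs! zs⊆S (λ _ → level2∉zs) ⟩
        length S + length transpose-missing      ≤⟨ +-monoˡ-≤ _ |S|≤C∸k ⟩
        C ∸ k + length transpose-missing         ∎)
        where
        open ≤-Reasoning
        transpose-injective : ∀ {b b'} → a ∷ b ∷ [] ≡ a ∷ b' ∷ [] → b ≡ b'
        transpose-injective = proj₁ ∘ ∷-injective ∘ proj₂ ∘ ∷-injective

      children-unobserved₀ : ∀ {v u} → branch v ≡ just a → u ∈ children a transpose-missing →
                             u ∈ wkpVerts C 2 × T (inN v u) × ¬ Observed 0 S u
      children-unobserved₀ branch-v u∈ch with ∈-map⁻ _ u∈ch
      ... | b , b∈M , refl =
        level2∈V b a , ∼⇒inN (branch∼children branch-v b) , transpose-missing-unobserved₀ b∈M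

      length-children : length (children a transpose-missing) ≡ length transpose-missing
      length-children = length-map _ transpose-missing

      -- An observer of a ∷ [] in S is a top vertex, so it is not among the transposes a ∷ b ∷ [].
      many-unobserved₀ : ∀ {v} → branch v ≡ just a →
                         ∃ λ L → Unique L × k < length L ×
                           (∀ {u} → u ∈ L → u ∈ wkpVerts C 2 × T (inN v u) × ¬ Observed 0 S u)
      many-unobserved₀ {v} branch-v with Observed? 0 S (a ∷ [])
      ... | no a∉P =
        (a ∷ []) ∷ children a transpose-missing ,
        All.tabulate (λ u∈ch a≡u → case ∈-map⁻ _ u∈ch of λ
                        { (_ , _ , refl) → level2≢top (sym a≡u) (s≤s (s≤s z≤n)) }) ∷
          children-unique transpose-missing-unique ,
        s≤s (subst (k ≤_) (sym length-children) (transpose-missing-bound {[]} [] (λ ()) (λ ()))) ,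
        λ { (here refl)  → level1∈V a , ∼⇒inN (∼-sym (branch-parent∼ branch-v)) , a∉P
          ; (there u∈ch) → children-unobserved₀ branch-v u∈ch }
      ... | yes a∈P with observed-zero⇒∼ S⊆V a∈P
      ... | s , s∈S , s∼a with ∼-into-level1 s∼a
      ... | inj₂ (_ , refl) = ⊥-elim (branch-∈ s∈S refl a∉)
      ... | inj₁ |s|<2 =
        children a transpose-missing , children-unique transpose-missing-unique ,
        subst (k <_) (sym length-children)
          (transpose-missing-bound {s ∷ []} ([] ∷ []) (λ { (here refl) → s∈S })
                                   (λ { (here eq) → level2≢top eq |s|<2 })) ,
        children-unobserved₀ branch-v

      diagonal-unobserved₁ : ¬ Observed 1 S (a ∷ a ∷ [])
      diagonal-unobserved₁ aa∈P with Observed-suc⁻ aa∈P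
      ... | v , v↝ , v∼aa
          with many-unobserved₀ (∼-diagonal⇒branch (inN⇒∼ (Propagates.∈verts v↝) v∼aa))
      ... | L , L! , k<|L| , L-unobserved = ¬propagates-if-many-unobserved L! k<|L| L-unobserved v↝

    ¬Full₁ : ∀ {S} → All (_∈ wkpVerts C 2) S → length S ≤ C ∸ k → ¬ Full k 1 S
    ¬Full₁ S⊆V |S|≤C∸k full with ∃-unbranched-letter (≤-<-trans |S|≤C∸k C∸k<C)
    ... | a , a∉ =
      DiagonalUnobserved₁.diagonal-unobserved₁ S⊆V |S|≤C∸k a∉ (Full⁻ full (level2∈V a a))

    isRad-3 : IsRad k 3
    isRad-3 = isRad-intro S₀-minPDS S₀-full₂ λ where
      S S-min zero          _ → ¬Full₀ (minPDS⊆verts S-min) (≤-<-trans (minPDS-size S-min) C∸k<C)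
      S S-min (suc zero)    _ → ¬Full₁ (minPDS⊆verts S-min) (minPDS-size S-min)
      _ _     (suc (suc _)) (s≤s (s≤s ()))

mainTheorem10 : (C k : ℕ) → 2 ≤ C → 1 ≤ k →
                  (C ≤ k → RadWKP C 2 k 2) × (k < C → RadWKP C 2 k 3)
mainTheorem10 C k 2≤C 1≤k =
  (λ C≤k → LargeThreshold.isRad-2 C≤k 2≤C) ,
  (λ k<C → SmallThreshold.isRad-3 k<C 1≤k)
  where open WKP₂Domination C k
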